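{- Let $n$ be a positive integer. Then, as species, $$\mathbf{C}_{(n)}\times\mathbf{C}_{(n)}=\sum_{d\mid n}\#\{P\in\mathbf{SP}_n:\ |\mathrm{Stab}(P)|=d\}\cdot\mathbf{C}_{(d^{n/d})}.$$ Equivalently, the coefficients $b^\mu_{n,n}$ defined by $\mathbf{C}_{(n)}(\mathbf{z})\star\mathbf{C}_{(n)}(\mathbf{z})=\sum_{\mu\vdash n}b^\mu_{n,n}\mathbf{C}_\mu(\mathbf{z})$ satisfy $b^\mu_{n,n}=\#\{P\in\mathbf{SP}_n:|\mathrm{Stab}(P)|=d\}$ if $\mu=(d^{n/d})$ for some $d\mid n$, and $b^\mu_{n,n}=0$ otherwise.
   Context: For $H\le S_n$, $X^n/H$ is the species with $(X^n/H)[U]=\{\lambda H:\lambda:[n]\to U\text{ bijection}\}$, $(X^n/H)[f](\lambda H)=(f\lambda)H$. For $\mu\vdash n$ the standard permutation $\sigma_\mu$ is the product of disjoint cycles filling cycles of lengths $\mu_1,\mu_2,\dots$ with $1,\dots,n$ in increasing order, $\mathbf{C}_\mu:=X^n/\langle\sigma_\mu\rangle$, and $\mathbf{C}_\mu(\mathbf{z})$ is its cycle index series; $(n)$ is the one-part partition and $(d^{n/d})$ the partition with $n/d$ parts equal to $d$. $\times$ is the Cartesian product of species ($(F\times G)[U]=F[U]\times G[U]$), $\star$ the Kronecker product, and integer multiples/sums of species are disjoint unions. Steggall patterns: an element of size $n$ is a permutation $(P_1,\dots,P_n)$ of $\{1,\dots,n\}$. The group $\mathbb{Z}_n\times\mathbb{Z}_n$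 acts on elements by $(r,k)\cdot(P_i)_i=(P_{i+r}+k \bmod n)_i$ (indices and values taken modulo $n$ in $\{1,\dots,n\}$), i.e. generated by the cyclic shift $(P_1,\dots,P_n)\mapsto(P_2,\dots,P_n,P_1)$ and translation of values modulo $n$. A Steggall pattern is an orbit of this action, and $\mathbf{SP}_n$ is the set of all patterns of size $n$. For a pattern $P$, $\mathrm{Stab}(P)=\{(r,k)\in\mathbb{Z}_n\times\mathbb{Z}_n:(P_{i+r}+k \bmod n)_i=(P_i)_i\}$, the stabiliser of a representative (its order does not depend on the representative). -}

module Defs where

open import Data.Nat using (ℕ; zero; suc; _+_; _*_; NonZero)
open import Data.Nat.DivMod using (_/_; _%_; _mod_)
open import Data.Nat.Divisibility using (_∣_; divides)
open import Data.Nat.Properties using (*-zeroʳ)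
open import Data.Fin using (Fin; toℕ)
open import Data.Fin.Properties using (all?) renaming (_≟_ to _≟ᶠ_)
open import Data.Fin.Permutation using (Permutation′; _⟨$⟩ʳ_; _∘ₚ_)
open import Data.List using (List; length; filter; cartesianProduct; allFin)
open import Data.Product using (Σ; Σ-syntax; ∃-syntax; _×_; _,_; proj₁; proj₂)
open import Relation.Binary.PropositionalEquality using (_≡_; refl; sym; subst; trans)
open import Relation.Nullary using (Dec)

Perm : ℕ → Set
Perm n = Permutation′ n

iter : {A : Set} → (A → A) → ℕ → A → A
iter f zero    x = x
iter f (suc k) x = f (iter f k x)

-- The standard permutation σ_(d^{n/d}) on Fin n (for d ∣ n):
-- cycles (0 1 … d-1)(d … 2d-1)…, i.e. i ↦ d⌊i/d⌋ + ((i mod d)+1 mod d).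
-- For d = n this is σ_(n) = (0 1 … n-1).  (The outer 'mod n' is only
-- there to land in Fin n; it is the identity when d ∣ n.)

σ : (n d : ℕ) {{_ : NonZero n}} {{_ : NonZero d}} → Fin n → Fin n
σ n d i = (d * (toℕ i / d) + (suc (toℕ i % d)) % d) mod n

-- Left cosets λH, H = ⟨σ_(d^{n/d})⟩ ≤ S_n, as the setoid relation
-- λ H = μ H  ⇔  μ = λ ∘ σ^k for some k.
SameCoset : (n d : ℕ) {{_ : NonZero n}} {{_ : NonZero d}} → Perm n → Perm n → Set
SameCoset n d λ′ μ = ∃[ k ] (∀ i → μ ⟨$⟩ʳ i ≡ λ′ ⟨$⟩ʳ iter (σ n d) k i)

-- Transport of structure along τ ∈ S_n: λH ↦ (τ ∘ λ)H.
transport : {n : ℕ} → Perm n → Perm n → Perm n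
transport τ λ′ = λ′ ∘ₚ τ      -- (λ′ ∘ₚ τ) ⟨$⟩ʳ i = τ ⟨$⟩ʳ (λ′ ⟨$⟩ʳ i)

-- Steggall patterns.  A permutation P of Fin n is the sequence
-- (P_0,…,P_{n-1}); (r,k) ∈ ℤ_n × ℤ_n acts by (P_{i+r} + k mod n)_i.

actSP : (n : ℕ) {{_ : NonZero n}} → Fin n → Fin n → Perm n → Fin n → Fin n
actSP n r k P i = (toℕ (P ⟨$⟩ʳ ((toℕ i + toℕ r) mod n)) + toℕ k) mod n

SamePattern : (n : ℕ) {{_ : NonZero n}} → Perm n → Perm n → Set
SamePattern n P Q = Σ[ r ∈ Fin n ] Σ[ k ∈ Fin n ] (∀ i → Q ⟨$⟩ʳ i ≡ actSP n r k P i)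

InStab : (n : ℕ) {{_ : NonZero n}} → Perm n → Fin n × Fin n → Set
InStab n P (r , k) = ∀ i → actSP n r k P i ≡ P ⟨$⟩ʳ i

inStab? : (n : ℕ) {{_ : NonZero n}} (P : Perm n) (rk : Fin n × Fin n) → Dec (InStab n P rk)
inStab? n P (r , k) = all? (λ i → actSP n r k P i ≟ᶠ P ⟨$⟩ʳ i)

stabSize : (n : ℕ) {{_ : NonZero n}} → Perm n → ℕ
stabSize n P = length (filter (inStab? n P) (cartesianProduct (allFin n) (allFin n)))

∣-nonZero : {d n : ℕ} → d ∣ n → {{_ : NonZero n}} → NonZero d
∣-nonZero {suc d} _ = _
∣-nonZero {zero} {zero} _ {{()}}
∣-nonZero {zero} {suc n} (divides q eq) with trans eq (*-zeroʳ q)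
... | ()

-- Species concentrated in degree n are encoded by their S_n-set on the
-- canonical label set Fin n (a setoid with an S_n-action by transport).
-- An isomorphism of such species = an S_n-equivariant bijection of setoids.

record SpeciesIso (n : ℕ)
    (A : Set) (_≈A_ : A → A → Set) (actA : Perm n → A → A)
    (B : Set) (_≈B_ : B → B → Set) (actB : Perm n → B → B) : Set where
  field
    to        : A → B
    from      : B → A
    to-cong   : ∀ {x y} → x ≈A y → to x ≈B to y
    from-cong : ∀ {x y} → x ≈B y → from x ≈A from y
    from-to   : ∀ x → from (to x) ≈A x
    to-from   : ∀ y → to (from y) ≈B y
    natural   : ∀ τ x → to (actA τ x) ≈B actB τ (to x)

-- C_(n) × C_(n)  on [n]:  pairs of cosets (λ₁H, λ₂H), H = ⟨σ_(n)⟩.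
CnCn : ℕ → Set
CnCn n = Perm n × Perm n

_≈CnCn_ : {n : ℕ} {{_ : NonZero n}} → CnCn n → CnCn n → Set
_≈CnCn_ {n} (λ₁ , λ₂) (μ₁ , μ₂) = SameCoset n n λ₁ μ₁ × SameCoset n n λ₂ μ₂

actCnCn : {n : ℕ} → Perm n → CnCn n → CnCn n
actCnCn τ (λ₁ , λ₂) = transport τ λ₁ , transport τ λ₂

-- Σ_{d ∣ n} #{P ∈ SP_n : |Stab P| = d} · C_(d^{n/d})  on [n], written as the
-- disjoint union, over Steggall patterns P with d = |Stab P| dividing n,
-- of a copy of C_(d^{n/d}).  Elements: (representative P, d ∣ n, λ);
-- the pattern index is taken up to SamePattern, the coset up to SameCoset.
RHS : (n : ℕ) {{_ : NonZero n}} → Set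
RHS n = Σ[ P ∈ Perm n ] Σ[ h ∈ stabSize n P ∣ n ] Perm n

_≈RHS_ : {n : ℕ} {{nz : NonZero n}} → RHS n → RHS n → Set
_≈RHS_ {n} {{nz}} (P , h , λ′) (Q , _ , μ) =
  SamePattern n P Q × SameCoset n (stabSize n P) {{nz}} {{∣-nonZero h {{nz}}}} λ′ μ

actRHS : {n : ℕ} {{_ : NonZero n}} → Perm n → RHS n → RHS n
actRHS τ (P , h , λ′) = P , h , transport τ λ′

module Submission where

-- For a pair (λ₁, λ₂) of labellings of the n-cycle put π = λ₁⁻¹λ₂.  Rotating λ₁ and λ₂
-- independently moves π exactly along its Steggall orbit, so the orbit, represented by its
-- lexicographically least member P = (r₀, k₀)·π, is an invariant of the pair; the pair is recovered
-- from P together with λ₂σ^{r₀}, which is determined only up to the rotations r for which some (r, k)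
-- stabilises P.  As k is determined by r, these rotations form a subgroup of ℤ_n of order
-- d = |Stab(P)|, namely the multiples of m = n/d.  Transposing the d × m grid of labels conjugates
-- σ_(d^{n/d}) into the rotation by m, so λ₂σ^{r₀} modulo these rotations is a point of C_(d^{n/d}).

open import Data.Empty using (⊥-elim)
open import Data.Fin using (Fin; toℕ)
open import Data.Fin.Permutation using (_⟨$⟩ʳ_; _⟨$⟩ˡ_; inverseˡ; inverseʳ; permutation; _∘ₚ_; flip)
open import Data.Fin.Properties using (toℕ-injective; toℕ-fromℕ<; toℕ<n; any?)
  renaming (_≟_ to _≟ᶠ_; ≤-totalOrder to Fin-≤-totalOrder)
open import Data.List
  using ([]; _∷_; [_]; _++_; map; filter; length; applyUpTo; upTo; tabulate; allFin; cartesianProduct)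
open import Data.List.Properties
  using (filter-++; filter-≐; map-upTo; length-++; filter-accept; filter-reject; filter-none; map-tabulate)
open import Data.List.Membership.Propositional using (_∈_)
open import Data.List.Membership.Propositional.Properties using (∈-allFin; ∈-cartesianProduct⁺)
open import Data.List.Relation.Unary.All as All using (All)
open import Data.List.Relation.Unary.All.Properties using (applyUpTo⁺₁; tabulate⁺)
open import Data.List.Relation.Unary.Any using (here; there)
open import Data.List.Relation.Unary.Unique.Propositional using (Unique; _∷_)
open import Data.List.Relation.Unary.Unique.Propositional.Properties using (allFin⁺)
open import Data.Nat
open import Data.Nat.DivMod
open import Data.Nat.Divisibility
open import Data.Nat.Induction using (<-rec)
open import Data.Nat.Properties
open import Data.Product using (∃-syntax; _×_; _,_; proj₁; proj₂)
open import Data.Vec as Vec using (Vec)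
open import Data.Vec.Properties using (tabulate-cong; lookup∘tabulate)
open import Data.Vec.Relation.Binary.Lex.NonStrict using () renaming (≤-totalOrder to lex-≤-totalOrder)
open import Data.Vec.Relation.Binary.Pointwise.Inductive using (Pointwise-≡⇒≡)
open import Function using (_∘_; _$_; it)
open import Function.Bundles using (Inverse)
open import Level using (0ℓ)
open import Relation.Binary.Bundles using (TotalOrder)
open import Relation.Binary.PropositionalEquality hiding ([_])
open import Relation.Nullary using (¬_; yes; no)
open import Relation.Nullary.Decidable using (_×-dec_)
open import Relation.Unary using (Pred; Decidable)
open ≡-Reasoning

open import Defs

module _ {a b p} {A : Set a} {B : Set b} {P : Pred B p} (P? : Decidable P) where

  length-filter-map : ∀ (f : A → B) xs → length (filter P? (map f xs)) ≡ length (filter (P? ∘ f) xs)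
  length-filter-map f []       = refl
  length-filter-map f (x ∷ xs) with P? (f x)
  ... | yes _ = cong suc (length-filter-map f xs)
  ... | no  _ = length-filter-map f xs

module _ {a p} {A : Set a} {P : Pred A p} (P? : Decidable P) where

  length-filter-++ : ∀ xs ys → length (filter P? (xs ++ ys)) ≡ length (filter P? xs) + length (filter P? ys)
  length-filter-++ xs ys = trans (cong length (filter-++ P? xs ys)) (length-++ (filter P? xs))

  length-filter-unique : ∀ {x xs} → Unique xs → x ∈ xs → P x → (∀ {y} → P y → y ≡ x) →
                         length (filter P? xs) ≡ 1
  length-filter-unique (y∉ys ∷ _) (here refl) Px onlyX =
    trans (cong length (filter-accept P? Px))
          (cong (suc ∘ length) (filter-none P? (All.map (λ y≢z Pz → y≢z (sym (onlyX Pz))) y∉ys)))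
  length-filter-unique (y∉ys ∷ uniq) (there x∈ys) Px onlyX =
    trans (cong length (filter-reject P? (λ Py → All.lookup y∉ys x∈ys (onlyX Py))))
          (length-filter-unique uniq x∈ys Px onlyX)

module _ {a b p q} {A : Set a} {B : Set b} {P : Pred (A × B) p} {Q : Pred A q}
         (P? : Decidable P) (Q? : Decidable Q) where

  length-filter-cartesianProduct : ∀ xs ys →
    (∀ x → length (filter (λ y → P? (x , y)) ys) ≡ length (filter Q? [ x ])) →
    length (filter P? (cartesianProduct xs ys)) ≡ length (filter Q? xs)
  length-filter-cartesianProduct []       ys fibre = refl
  length-filter-cartesianProduct (x ∷ xs) ys fibre = begin
    length (filter P? (map (x ,_) ys ++ cartesianProduct xs ys))
      ≡⟨ length-filter-++ P? (map (x ,_) ys) _ ⟩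
    length (filter P? (map (x ,_) ys)) + length (filter P? (cartesianProduct xs ys))
      ≡⟨ cong₂ _+_ (trans (length-filter-map P? (x ,_) ys) (fibre x))
                   (length-filter-cartesianProduct xs ys fibre) ⟩
    length (filter Q? [ x ]) + length (filter Q? xs)
      ≡⟨ length-filter-++ Q? [ x ] xs ⟨
    length (filter Q? (x ∷ xs)) ∎

applyUpTo-+ : ∀ {a} {A : Set a} (f : ℕ → A) m k →
              applyUpTo f (m + k) ≡ applyUpTo f m ++ applyUpTo (f ∘ (m +_)) k
applyUpTo-+ f zero    k = refl
applyUpTo-+ f (suc m) k = cong (f 0 ∷_) (applyUpTo-+ (f ∘ suc) m k)

tabulate-∘toℕ : ∀ {a} {A : Set a} (f : ℕ → A) n → tabulate (f ∘ toℕ {n}) ≡ applyUpTo f n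
tabulate-∘toℕ f zero    = refl
tabulate-∘toℕ f (suc n) = cong (f 0 ∷_) (tabulate-∘toℕ (f ∘ suc) n)

map-toℕ-allFin : ∀ n → map toℕ (allFin n) ≡ upTo n
map-toℕ-allFin n = trans (map-tabulate (λ i → i) toℕ) (tabulate-∘toℕ (λ i → i) n)

length-filter-∣-upTo : ∀ g .{{_ : NonZero g}} q → length (filter (g ∣?_) (upTo (q * g))) ≡ q
length-filter-∣-upTo g zero    = refl
length-filter-∣-upTo g (suc q) = begin
  length (filter (g ∣?_) (upTo (g + q * g)))
    ≡⟨ cong (length ∘ filter (g ∣?_)) (applyUpTo-+ (λ i → i) g (q * g)) ⟩
  length (filter (g ∣?_) (upTo g ++ applyUpTo (g +_) (q * g)))
    ≡⟨ length-filter-++ (g ∣?_) (upTo g) _ ⟩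
  length (filter (g ∣?_) (upTo g)) + length (filter (g ∣?_) (applyUpTo (g +_) (q * g)))
    ≡⟨ cong₂ _+_ (first-block g) later-blocks ⟩
  1 + length (filter (g ∣?_) (upTo (q * g)))
    ≡⟨ cong suc (length-filter-∣-upTo g q) ⟩
  suc q ∎
  where
  first-block : ∀ g .{{_ : NonZero g}} → length (filter (g ∣?_) (upTo g)) ≡ 1
  first-block zero {{()}}
  first-block g@(suc g′) = trans (cong length (filter-accept (g ∣?_) {xs = applyUpTo suc g′} (g ∣0)))
    (cong (suc ∘ length) (filter-none (g ∣?_) (applyUpTo⁺₁ suc g′ λ i<g′ g∣1+i →
      <⇒≱ (s<s i<g′) (∣⇒≤ g∣1+i))))

  ∣g+i⇒∣i : ∀ {i} → g ∣ g + i → g ∣ i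
  ∣g+i⇒∣i g∣g+i = ∣m+n∣m⇒∣n g∣g+i ∣-refl

  later-blocks : length (filter (g ∣?_) (applyUpTo (g +_) (q * g))) ≡ length (filter (g ∣?_) (upTo (q * g)))
  later-blocks = begin
    length (filter (g ∣?_) (applyUpTo (g +_) (q * g)))
      ≡⟨ cong (length ∘ filter (g ∣?_)) (map-upTo (g +_) (q * g)) ⟨
    length (filter (g ∣?_) (map (g +_) (upTo (q * g))))
      ≡⟨ length-filter-map (g ∣?_) (g +_) (upTo (q * g)) ⟩
    length (filter (λ i → g ∣? (g + i)) (upTo (q * g)))
      ≡⟨ cong length (filter-≐ (λ i → g ∣? (g + i)) (g ∣?_) (∣g+i⇒∣i , ∣m∣n⇒∣m+n ∣-refl) (upTo (q * g))) ⟩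
    length (filter (g ∣?_) (upTo (q * g))) ∎

LeastSuch : ∀ {p} → Pred ℕ p → Set p
LeastSuch P = ∃[ g ] P g × (∀ {y} → y < g → ¬ P y)

least : ∀ {p} {P : Pred ℕ p} → Decidable P → ∀ m → P m → LeastSuch P
least {P = P} P? = <-rec (λ m → P m → LeastSuch P) search
  where
  search : ∀ m → (∀ {y} → y < m → P y → LeastSuch P) → P m → LeastSuch P
  search m below Pm with anyUpTo? P? m
  ... | yes (y , y<m , Py) = below y<m Py
  ... | no  none           = m , Pm , λ y<m Py → none (_ , y<m , Py)

[t+qk]%k≡t : ∀ {t k} q .{{_ : NonZero k}} → t < k → (t + q * k) % k ≡ t
[t+qk]%k≡t {t} {k} q t<k = trans ([m+kn]%n≡m%n t q k) (m<n⇒m%n≡m t<k)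

[t+qk]/k≡q : ∀ {t k} q .{{_ : NonZero k}} → t < k → (t + q * k) / k ≡ q
[t+qk]/k≡q {t} {k} q t<k = begin
  (t + q * k) / k   ≡⟨ +-distrib-/-∣ʳ t (n∣m*n q) ⟩
  t / k + q * k / k ≡⟨ cong₂ _+_ (m<n⇒m/n≡0 t<k) (m*n/n≡m q k) ⟩
  q                 ∎

q+tb<ab : ∀ {q t a b} → q < b → t < a → q + t * b < a * b
q+tb<ab {q} {t} {a} {b} q<b t<a = <-≤-trans (+-monoˡ-< (t * b) q<b) (*-monoˡ-≤ b t<a)

module Modulo (n : ℕ) {{_ : NonZero n}} where

  toℕ-mod : ∀ x → toℕ (x mod n) ≡ x % n
  toℕ-mod x = toℕ-fromℕ< (m%n<n x n)

  %n-toℕ-mod : ∀ x → toℕ (x mod n) % n ≡ x % n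
  %n-toℕ-mod x = trans (cong (_% n) (toℕ-mod x)) (m%n%n≡m%n x n)

  mod-cong : ∀ {x y} → x % n ≡ y % n → x mod n ≡ y mod n
  mod-cong {x} {y} eq = toℕ-injective (trans (toℕ-mod x) (trans eq (sym (toℕ-mod y))))

  toℕ-mod-toℕ : (i : Fin n) → toℕ i mod n ≡ i
  toℕ-mod-toℕ i = toℕ-injective (trans (toℕ-mod (toℕ i)) (m<n⇒m%n≡m (toℕ<n i)))

  [x+y%n]%n≡[x+y]%n : ∀ x y → (x + y % n) % n ≡ (x + y) % n
  [x+y%n]%n≡[x+y]%n x y = begin
    (x + y % n) % n         ≡⟨ %-distribˡ-+ x (y % n) n ⟩
    (x % n + y % n % n) % n ≡⟨ cong (λ z → (x % n + z) % n) (m%n%n≡m%n y n) ⟩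
    (x % n + y % n) % n     ≡⟨ %-distribˡ-+ x y n ⟨
    (x + y) % n             ∎

  [x%n+y]%n≡[x+y]%n : ∀ x y → (x % n + y) % n ≡ (x + y) % n
  [x%n+y]%n≡[x+y]%n x y = begin
    (x % n + y) % n ≡⟨ cong (_% n) (+-comm (x % n) y) ⟩
    (y + x % n) % n ≡⟨ [x+y%n]%n≡[x+y]%n y x ⟩
    (y + x) % n     ≡⟨ cong (_% n) (+-comm y x) ⟩
    (x + y) % n     ∎

  [x+r+[n∸r]]%n≡x%n : ∀ {r} x → r ≤ n → (x + r + (n ∸ r)) % n ≡ x % n
  [x+r+[n∸r]]%n≡x%n {r} x r≤n = begin
    (x + r + (n ∸ r)) % n   ≡⟨ cong (_% n) (+-assoc x r (n ∸ r)) ⟩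
    (x + (r + (n ∸ r))) % n ≡⟨ cong (λ y → (x + y) % n) (m+[n∸m]≡n r≤n) ⟩
    (x + n) % n             ≡⟨ [m+n]%n≡m%n x n ⟩
    x % n                   ∎

  [r+[x+[n∸r]]%n]%n≡x%n : ∀ {r} x → r ≤ n → (r + toℕ ((x + (n ∸ r)) mod n)) % n ≡ x % n
  [r+[x+[n∸r]]%n]%n≡x%n {r} x r≤n = begin
    (r + toℕ ((x + (n ∸ r)) mod n)) % n ≡⟨ cong (λ y → (r + y) % n) (toℕ-mod (x + (n ∸ r))) ⟩
    (r + (x + (n ∸ r)) % n) % n         ≡⟨ [x+y%n]%n≡[x+y]%n r (x + (n ∸ r)) ⟩
    (r + (x + (n ∸ r))) % n             ≡⟨ cong (_% n) (sym (+-assoc r x (n ∸ r))) ⟩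
    (r + x + (n ∸ r)) % n               ≡⟨ cong (λ y → (y + (n ∸ r)) % n) (+-comm r x) ⟩
    (x + r + (n ∸ r)) % n               ≡⟨ [x+r+[n∸r]]%n≡x%n x r≤n ⟩
    x % n                               ∎

  %-cancel-+ˡ : ∀ {x a b} → x ≤ n → (x + a) % n ≡ (x + b) % n → a % n ≡ b % n
  %-cancel-+ˡ {x} {a} {b} x≤n eq = begin
    a % n                       ≡⟨ shift-back a ⟨
    (x + a + (n ∸ x)) % n       ≡⟨ [x%n+y]%n≡[x+y]%n (x + a) (n ∸ x) ⟨
    ((x + a) % n + (n ∸ x)) % n ≡⟨ cong (λ y → (y + (n ∸ x)) % n) eq ⟩
    ((x + b) % n + (n ∸ x)) % n ≡⟨ [x%n+y]%n≡[x+y]%n (x + b) (n ∸ x) ⟩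
    (x + b + (n ∸ x)) % n       ≡⟨ shift-back b ⟩
    b % n                       ∎
    where
    shift-back : ∀ c → (x + c + (n ∸ x)) % n ≡ c % n
    shift-back c = trans (cong (λ y → (y + (n ∸ x)) % n) (+-comm x c)) ([x+r+[n∸r]]%n≡x%n c x≤n)

  +-complement%n : (r : Fin n) → (toℕ r + (n ∸ toℕ r)) % n ≡ 0
  +-complement%n r = trans (cong (_% n) (m+[n∸m]≡n (<⇒≤ (toℕ<n r)))) (n%n≡0 n)

module CyclicSubgroup (n : ℕ) {{_ : NonZero n}} {ℓ} {R : Pred (Fin n) ℓ} (R? : Decidable R)
  (R-0 : R (0 mod n)) (R-+ : ∀ {a b} → R a → R b → R ((toℕ a + toℕ b) mod n)) where
  open Modulo n

  private
    Q : Pred ℕ ℓ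
    Q x = R (x mod n)

    Q-0 : Q 0
    Q-0 = R-0

    Q-n : Q n
    Q-n = subst R (mod-cong (trans (m*n%n≡0 0 n) (sym (n%n≡0 n)))) R-0

    Q-+ : ∀ {x y} → Q x → Q y → Q (x + y)
    Q-+ {x} {y} Qx Qy = subst R (mod-cong (begin
      (toℕ (x mod n) + toℕ (y mod n)) % n ≡⟨ cong₂ (λ a b → (a + b) % n) (toℕ-mod x) (toℕ-mod y) ⟩
      (x % n + y % n) % n                 ≡⟨ %-distribˡ-+ x y n ⟨
      (x + y) % n                         ∎)) (R-+ Qx Qy)

    Q-%n : ∀ {x} → Q x → Q (x % n)
    Q-%n {x} = subst R (mod-cong (sym (m%n%n≡m%n x n)))

    least-positive : LeastSuch (λ y → 0 < y × Q y)
    least-positive = least (λ y → (0 <? y) ×-dec R? (y mod n)) n (>-nonZero⁻¹ n , Q-n)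

  generator : ℕ
  generator = proj₁ least-positive

  generator-nonZero : NonZero generator
  generator-nonZero = >-nonZero (proj₁ (proj₁ (proj₂ least-positive)))

  private instance _ = generator-nonZero

  private
    g = generator

    Q-g : Q g
    Q-g = proj₂ (proj₁ (proj₂ least-positive))

    below-g : ∀ {y} → y < g → 0 < y → ¬ Q y
    below-g y<g 0<y Qy = proj₂ (proj₂ least-positive) y<g (0<y , Qy)

    g≤n : g ≤ n
    g≤n = ≮⇒≥ λ n<g → below-g n<g (>-nonZero⁻¹ n) Q-n

    ∣⇒Q : ∀ {x} → g ∣ x → Q x
    ∣⇒Q (divides j refl) = Q-multiple j
      where
      Q-multiple : ∀ j → Q (j * g)
      Q-multiple zero    = Q-0
      Q-multiple (suc j) = Q-+ Q-g (Q-multiple j)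

    -- x + (n - 1)(x / g)g ≡ x % g (mod n) lies in Q, so the remainder x % g < g must vanish.
    Q⇒∣ : ∀ {x} → Q x → g ∣ x
    Q⇒∣ {x} Qx with x % g in eq
    ... | zero  = m%n≡0⇒n∣m x g eq
    ... | suc _ = ⊥-elim (below-g (subst (_< g) eq (m%n<n x g)) z<s (subst Q eq Q-remainder))
      where
      q = x / g
      [x+[n-1]qg]%n≡x%g : (x + pred n * (q * g)) % n ≡ x % g
      [x+[n-1]qg]%n≡x%g = begin
        (x + pred n * (q * g)) % n
          ≡⟨ cong (λ y → (y + pred n * (q * g)) % n) (m≡m%n+[m/n]*n x g) ⟩
        (x % g + q * g + pred n * (q * g)) % n
          ≡⟨ cong (_% n) (+-assoc (x % g) (q * g) _) ⟩
        (x % g + suc (pred n) * (q * g)) % n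
          ≡⟨ cong (λ k → (x % g + k * (q * g)) % n) (suc-pred n) ⟩
        (x % g + n * (q * g)) % n
          ≡⟨ cong (λ y → (x % g + y) % n) (*-comm n (q * g)) ⟩
        (x % g + (q * g) * n) % n
          ≡⟨ [m+kn]%n≡m%n (x % g) (q * g) n ⟩
        x % g % n
          ≡⟨ m<n⇒m%n≡m (<-≤-trans (m%n<n x g) g≤n) ⟩
        x % g ∎
      Q-remainder : Q (x % g)
      Q-remainder = subst Q [x+[n-1]qg]%n≡x%g (Q-%n (Q-+ Qx (∣⇒Q (∣-trans (n∣m*n q) (n∣m*n (pred n))))))

  generator∣n : generator ∣ n
  generator∣n = Q⇒∣ Q-n

  R⇒∣ : ∀ {r} → R r → generator ∣ toℕ r
  R⇒∣ {r} Rr = Q⇒∣ (subst R (sym (toℕ-mod-toℕ r)) Rr)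

  ∣⇒R : ∀ {r} → generator ∣ toℕ r → R r
  ∣⇒R {r} g∣r = subst R (toℕ-mod-toℕ r) (∣⇒Q g∣r)

  count : length (filter R? (allFin n)) ≡ n / generator
  count = begin
    length (filter R? (allFin n))
      ≡⟨ cong length (filter-≐ R? (λ i → g ∣? toℕ i) (R⇒∣ , ∣⇒R) (allFin n)) ⟩
    length (filter ((g ∣?_) ∘ toℕ) (allFin n))
      ≡⟨ length-filter-map (g ∣?_) toℕ (allFin n) ⟨
    length (filter (g ∣?_) (map toℕ (allFin n)))
      ≡⟨ cong (length ∘ filter (g ∣?_)) (map-toℕ-allFin n) ⟩
    length (filter (g ∣?_) (upTo n))
      ≡⟨ cong (length ∘ filter (g ∣?_) ∘ upTo) (m/n*n≡m generator∣n) ⟨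
    length (filter (g ∣?_) (upTo (n / g * g)))
      ≡⟨ length-filter-∣-upTo g (n / g) ⟩
    n / g ∎

module Rotation (n : ℕ) {{_ : NonZero n}} where
  open Modulo n

  rot : ℕ → Fin n → Fin n
  rot a i = (toℕ i + a) mod n

  rot-cong : ∀ {a b} → a % n ≡ b % n → ∀ i → rot a i ≡ rot b i
  rot-cong {a} {b} eq i = mod-cong $ begin
    (toℕ i + a) % n     ≡⟨ [x+y%n]%n≡[x+y]%n (toℕ i) a ⟨
    (toℕ i + a % n) % n ≡⟨ cong (λ x → (toℕ i + x) % n) eq ⟩
    (toℕ i + b % n) % n ≡⟨ [x+y%n]%n≡[x+y]%n (toℕ i) b ⟩
    (toℕ i + b) % n     ∎

  rot-mod : ∀ a i → rot (toℕ (a mod n)) i ≡ rot a i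
  rot-mod a = rot-cong (%n-toℕ-mod a)

  rot-0 : ∀ i → rot 0 i ≡ i
  rot-0 i = trans (cong (_mod n) (+-identityʳ (toℕ i))) (toℕ-mod-toℕ i)

  rot-multiple : ∀ {a} → a % n ≡ 0 → ∀ i → rot a i ≡ i
  rot-multiple eq i = trans (rot-cong (trans eq (sym (m*n%n≡0 0 n))) i) (rot-0 i)

  rot-+ : ∀ a b i → rot b (rot a i) ≡ rot (a + b) i
  rot-+ a b i = mod-cong $ begin
    (toℕ (rot a i) + b) % n   ≡⟨ cong (λ x → (x + b) % n) (toℕ-mod (toℕ i + a)) ⟩
    ((toℕ i + a) % n + b) % n ≡⟨ [x%n+y]%n≡[x+y]%n (toℕ i + a) b ⟩
    (toℕ i + a + b) % n       ≡⟨ cong (_% n) (+-assoc (toℕ i) a b) ⟩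
    (toℕ i + (a + b)) % n     ∎

  rot-comm : ∀ a b i → rot a (rot b i) ≡ rot b (rot a i)
  rot-comm a b i = trans (rot-+ b a i) (trans (cong (λ c → rot c i) (+-comm b a)) (sym (rot-+ a b i)))

  rot-injectiveˡ : ∀ {a b} x → rot a x ≡ rot b x → a % n ≡ b % n
  rot-injectiveˡ {a} {b} x eq = %-cancel-+ˡ (<⇒≤ (toℕ<n x))
    (trans (sym (toℕ-mod (toℕ x + a))) (trans (cong toℕ eq) (toℕ-mod (toℕ x + b))))

  abstract
    rot-complement : ∀ (r : Fin n) i → rot (n ∸ toℕ r) (rot (toℕ r) i) ≡ i
    rot-complement r i = trans (rot-+ (toℕ r) (n ∸ toℕ r) i) (rot-multiple (+-complement%n r) i)

    rot-complementʳ : ∀ (r : Fin n) i → rot (toℕ r) (rot (n ∸ toℕ r) i) ≡ i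
    rot-complementʳ r i = trans (rot-+ (n ∸ toℕ r) (toℕ r) i)
      (rot-multiple (trans (cong (_% n) (+-comm (n ∸ toℕ r) (toℕ r))) (+-complement%n r)) i)

  rotPerm : Fin n → Perm n
  rotPerm r = permutation (rot (toℕ r)) (rot (n ∸ toℕ r)) (rot-complementʳ r) (rot-complement r)

  σ-n : ∀ i → σ n n i ≡ rot 1 i
  σ-n i = mod-cong $ begin
    (n * (toℕ i / n) + suc (toℕ i % n) % n) % n ≡⟨ cong (λ q → (n * q + suc (toℕ i % n) % n) % n) i/n≡0 ⟩
    (n * 0 + suc (toℕ i % n) % n) % n         ≡⟨ cong (λ x → (x + suc (toℕ i % n) % n) % n) (*-zeroʳ n) ⟩
    suc (toℕ i % n) % n % n                   ≡⟨ m%n%n≡m%n (suc (toℕ i % n)) n ⟩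
    suc (toℕ i % n) % n                       ≡⟨ cong (λ x → suc x % n) (m<n⇒m%n≡m (toℕ<n i)) ⟩
    suc (toℕ i) % n                           ≡⟨ cong (_% n) (+-comm 1 (toℕ i)) ⟩
    (toℕ i + 1) % n                           ∎
    where i/n≡0 = m<n⇒m/n≡0 (toℕ<n i)

  iter-σ-n : ∀ k i → iter (σ n n) k i ≡ rot k i
  iter-σ-n zero    i = sym (rot-0 i)
  iter-σ-n (suc k) i = begin
    σ n n (iter (σ n n) k i) ≡⟨ cong (σ n n) (iter-σ-n k i) ⟩
    σ n n (rot k i)          ≡⟨ σ-n (rot k i) ⟩
    rot 1 (rot k i)          ≡⟨ rot-+ k 1 i ⟩
    rot (k + 1) i            ≡⟨ cong (λ a → rot a i) (+-comm k 1) ⟩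
    rot (suc k) i            ∎

  sameCoset-n : ∀ {λ₁ μ₁ : Perm n} k → (∀ i → μ₁ ⟨$⟩ʳ i ≡ λ₁ ⟨$⟩ʳ rot k i) → SameCoset n n λ₁ μ₁
  sameCoset-n {λ₁} k μ₁≗λ₁rot = k , λ i → trans (μ₁≗λ₁rot i) (cong (λ₁ ⟨$⟩ʳ_) (sym (iter-σ-n k i)))

  inverse-rot : ∀ {λ₁ μ₁ : Perm n} a → (∀ i → μ₁ ⟨$⟩ʳ i ≡ λ₁ ⟨$⟩ʳ rot a i) →
                ∀ x → μ₁ ⟨$⟩ˡ x ≡ rot (n ∸ toℕ (a mod n)) (λ₁ ⟨$⟩ˡ x)
  inverse-rot {λ₁} {μ₁} a μ₁≗λ₁rot x = Inverse.inverseʳ μ₁ $ sym $ begin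
    μ₁ ⟨$⟩ʳ rot (n ∸ a′) (λ₁ ⟨$⟩ˡ x)          ≡⟨ μ₁≗λ₁rot _ ⟩
    λ₁ ⟨$⟩ʳ rot a (rot (n ∸ a′) (λ₁ ⟨$⟩ˡ x))  ≡⟨ cong (λ₁ ⟨$⟩ʳ_) (rot-mod a _) ⟨
    λ₁ ⟨$⟩ʳ rot a′ (rot (n ∸ a′) (λ₁ ⟨$⟩ˡ x)) ≡⟨ cong (λ₁ ⟨$⟩ʳ_) (rot-complementʳ (a mod n) _) ⟩
    λ₁ ⟨$⟩ʳ (λ₁ ⟨$⟩ˡ x)                       ≡⟨ inverseʳ λ₁ ⟩
    x                                         ∎
    where a′ = toℕ (a mod n)

module SteggallAction (n : ℕ) {{_ : NonZero n}} where
  open Modulo n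
  open Rotation n

  -- actSP n r k P is definitionally act (toℕ r) (toℕ k) (P ⟨$⟩ʳ_); natural-number amounts can be
  -- added without reducing modulo n.
  act : ℕ → ℕ → (Fin n → Fin n) → Fin n → Fin n
  act a b f i = rot b (f (rot a i))

  act-cong : ∀ {a a′ b b′} {f g : Fin n → Fin n} → a % n ≡ a′ % n → b % n ≡ b′ % n → (∀ i → f i ≡ g i) →
             ∀ i → act a b f i ≡ act a′ b′ g i
  act-cong {a} {a′} {b} {b′} {f} {g} a≡a′ b≡b′ f≗g i = begin
    rot b (f (rot a i))   ≡⟨ rot-cong b≡b′ _ ⟩
    rot b′ (f (rot a i))  ≡⟨ cong (rot b′) (f≗g _) ⟩
    rot b′ (g (rot a i))  ≡⟨ cong (rot b′ ∘ g) (rot-cong a≡a′ i) ⟩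
    rot b′ (g (rot a′ i)) ∎

  act-mod : ∀ a b (f : Fin n → Fin n) i → act (toℕ (a mod n)) (toℕ (b mod n)) f i ≡ act a b f i
  act-mod a b f = act-cong {f = f} (%n-toℕ-mod a) (%n-toℕ-mod b) (λ _ → refl)

  act-0 : ∀ (f : Fin n → Fin n) i → act 0 0 f i ≡ f i
  act-0 f i = trans (rot-0 _) (cong f (rot-0 i))

  act-act : ∀ a b c e (f : Fin n → Fin n) i → act a b (act c e f) i ≡ act (a + c) (e + b) f i
  act-act a b c e f i = trans (rot-+ e b _) (cong (rot (e + b) ∘ f) (rot-+ a c i))

  act-inverse : ∀ (r k : Fin n) {f g : Fin n → Fin n} → (∀ i → g i ≡ act (toℕ r) (toℕ k) f i) →
                ∀ i → f i ≡ act (n ∸ toℕ r) (n ∸ toℕ k) g i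
  act-inverse r k {f} {g} g≗rkf i = sym $ begin
    rot (n ∸ toℕ k) (g (rot (n ∸ toℕ r) i))                              ≡⟨ cong (rot (n ∸ toℕ k)) (g≗rkf _) ⟩
    rot (n ∸ toℕ k) (rot (toℕ k) (f (rot (toℕ r) (rot (n ∸ toℕ r) i)))) ≡⟨ rot-complement k _ ⟩
    f (rot (toℕ r) (rot (n ∸ toℕ r) i))                                  ≡⟨ cong f (rot-complementʳ r i) ⟩
    f i                                                                  ∎

  ⟨$⟩ˡ-cong : ∀ {P Q : Perm n} → (∀ i → Q ⟨$⟩ʳ i ≡ P ⟨$⟩ʳ i) → ∀ y → Q ⟨$⟩ˡ y ≡ P ⟨$⟩ˡ y
  ⟨$⟩ˡ-cong {P} {Q} Q≗P y = Inverse.inverseʳ Q (sym (trans (Q≗P _) (inverseʳ P)))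

  inverse-act : ∀ {P Q : Perm n} (r k : Fin n) → (∀ i → Q ⟨$⟩ʳ i ≡ act (toℕ r) (toℕ k) (P ⟨$⟩ʳ_) i) →
                ∀ x → Q ⟨$⟩ˡ rot (toℕ k) x ≡ rot (n ∸ toℕ r) (P ⟨$⟩ˡ x)
  inverse-act {P} {Q} r k Q≗rkP x = Inverse.inverseʳ Q $ sym $ begin
    Q ⟨$⟩ʳ rot (n ∸ toℕ r) (P ⟨$⟩ˡ x)
      ≡⟨ Q≗rkP _ ⟩
    rot (toℕ k) (P ⟨$⟩ʳ rot (toℕ r) (rot (n ∸ toℕ r) (P ⟨$⟩ˡ x)))
      ≡⟨ cong (rot (toℕ k) ∘ (P ⟨$⟩ʳ_)) (rot-complementʳ r _) ⟩
    rot (toℕ k) (P ⟨$⟩ʳ (P ⟨$⟩ˡ x))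
      ≡⟨ cong (rot (toℕ k)) (inverseʳ P) ⟩
    rot (toℕ k) x ∎

  samePattern : ∀ a b {P Q : Perm n} → (∀ i → Q ⟨$⟩ʳ i ≡ act a b (P ⟨$⟩ʳ_) i) → SamePattern n P Q
  samePattern a b {P} Q≗abP = a mod n , b mod n , λ i → trans (Q≗abP i) (sym (act-mod a b (P ⟨$⟩ʳ_) i))

  samePattern-≗ : ∀ {P Q} → (∀ i → Q ⟨$⟩ʳ i ≡ P ⟨$⟩ʳ i) → SamePattern n P Q
  samePattern-≗ {P} {Q} Q≗P = samePattern 0 0 {P} {Q} λ i → trans (Q≗P i) (sym (act-0 (P ⟨$⟩ʳ_) i))

  samePattern-sym : ∀ {P Q} → SamePattern n P Q → SamePattern n Q P
  samePattern-sym {P} {Q} (r , k , Q≗rkP) = samePattern (n ∸ toℕ r) (n ∸ toℕ k) {Q} {P} (act-inverse r k Q≗rkP)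

module Stabiliser (n : ℕ) {{_ : NonZero n}} where
  open Rotation n
  open SteggallAction n

  inStab-transport : ∀ a b {P Q : Perm n} → (∀ i → Q ⟨$⟩ʳ i ≡ act a b (P ⟨$⟩ʳ_) i) →
                     ∀ {rk} → InStab n P rk → InStab n Q rk
  inStab-transport a b {P} {Q} Q≗abP {r , k} rk∈P i = begin
    rot (toℕ k) (Q ⟨$⟩ʳ rot (toℕ r) i)
      ≡⟨ cong (rot (toℕ k)) (Q≗abP _) ⟩
    rot (toℕ k) (rot b (P ⟨$⟩ʳ rot a (rot (toℕ r) i)))
      ≡⟨ rot-comm (toℕ k) b _ ⟩
    rot b (rot (toℕ k) (P ⟨$⟩ʳ rot a (rot (toℕ r) i)))
      ≡⟨ cong (λ j → rot b (rot (toℕ k) (P ⟨$⟩ʳ j))) (rot-comm a (toℕ r) i) ⟩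
    rot b (rot (toℕ k) (P ⟨$⟩ʳ rot (toℕ r) (rot a i)))
      ≡⟨ cong (rot b) (rk∈P (rot a i)) ⟩
    rot b (P ⟨$⟩ʳ rot a i)
      ≡⟨ Q≗abP i ⟨
    Q ⟨$⟩ʳ i ∎

  stabSize-cong : ∀ {P Q} → SamePattern n P Q → stabSize n Q ≡ stabSize n P
  stabSize-cong {P} {Q} P~Q@(r , k , Q≗rkP) with r′ , k′ , P≗r′k′Q ← samePattern-sym {P} {Q} P~Q =
    cong length (filter-≐ (inStab? n Q) (inStab? n P)
                  (inStab-transport (toℕ r′) (toℕ k′) {Q} {P} P≗r′k′Q , inStab-transport (toℕ r) (toℕ k) {P} {Q} Q≗rkP)
                  (cartesianProduct (allFin n) (allFin n)))

  stab-unique : ∀ {P r k k′} → InStab n P (r , k) → InStab n P (r , k′) → k ≡ k′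
  stab-unique {P} {r} {k} {k′} rk∈P rk′∈P = toℕ-injective $ begin
    toℕ k      ≡⟨ m<n⇒m%n≡m (toℕ<n k) ⟨
    toℕ k % n  ≡⟨ rot-injectiveˡ _ (trans (rk∈P (0 mod n)) (sym (rk′∈P (0 mod n)))) ⟩
    toℕ k′ % n ≡⟨ m<n⇒m%n≡m (toℕ<n k′) ⟩
    toℕ k′     ∎

  inStab-inverse : ∀ {P r k} → InStab n P (r , k) → ∀ y → rot (toℕ r) (P ⟨$⟩ˡ y) ≡ P ⟨$⟩ˡ rot (n ∸ toℕ k) y
  inStab-inverse {P} {r} {k} rk∈P y = sym $ Inverse.inverseʳ P $ begin
    rot (n ∸ toℕ k) y                                            ≡⟨ cong (rot (n ∸ toℕ k)) (inverseʳ P) ⟨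
    rot (n ∸ toℕ k) (P ⟨$⟩ʳ (P ⟨$⟩ˡ y))                           ≡⟨ cong (rot (n ∸ toℕ k)) (rk∈P _) ⟨
    rot (n ∸ toℕ k) (rot (toℕ k) (P ⟨$⟩ʳ rot (toℕ r) (P ⟨$⟩ˡ y))) ≡⟨ rot-complement k _ ⟩
    P ⟨$⟩ʳ rot (toℕ r) (P ⟨$⟩ˡ y)                                 ∎

  InStab₁ : Perm n → Pred (Fin n) 0ℓ
  InStab₁ P r = ∃[ k ] InStab n P (r , k)

  inStab₁? : (P : Perm n) → Decidable (InStab₁ P)
  inStab₁? P r = any? (λ k → inStab? n P (r , k))

  inStab₁-0 : ∀ P → InStab₁ P (0 mod n)
  inStab₁-0 P = 0 mod n , λ i → trans (act-mod 0 0 (P ⟨$⟩ʳ_) i) (act-0 (P ⟨$⟩ʳ_) i)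

  inStab₁-+ : ∀ P {a b} → InStab₁ P a → InStab₁ P b → InStab₁ P ((toℕ a + toℕ b) mod n)
  inStab₁-+ P {a} {b} (ka , a∈P) (kb , b∈P) = (toℕ ka + toℕ kb) mod n , λ i → begin
    act (toℕ ((toℕ a + toℕ b) mod n)) (toℕ ((toℕ ka + toℕ kb) mod n)) P′ i ≡⟨ act-mod (toℕ a + toℕ b) _ P′ i ⟩
    act (toℕ a + toℕ b) (toℕ ka + toℕ kb) P′ i       ≡⟨ act-cong {f = P′} refl ka+kb≡kb+ka (λ _ → refl) i ⟩
    act (toℕ a + toℕ b) (toℕ kb + toℕ ka) P′ i       ≡⟨ act-act (toℕ a) (toℕ ka) (toℕ b) (toℕ kb) P′ i ⟨
    act (toℕ a) (toℕ ka) (act (toℕ b) (toℕ kb) P′) i ≡⟨ act-cong refl refl b∈P i ⟩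
    act (toℕ a) (toℕ ka) P′ i                        ≡⟨ a∈P i ⟩
    P′ i                                             ∎
    where
    P′ = P ⟨$⟩ʳ_
    ka+kb≡kb+ka = cong (_% n) (+-comm (toℕ ka) (toℕ kb))

  inStab₁-transport : ∀ {P Q} → SamePattern n P Q → ∀ {r} → InStab₁ P r → InStab₁ Q r
  inStab₁-transport {P} {Q} (a , b , Q≗abP) (k , rk∈P) = k , inStab-transport (toℕ a) (toℕ b) {P} {Q} Q≗abP rk∈P

  inStab₁-difference : ∀ {P Q : Perm n} (r k : Fin n) x y →
    (∀ i → Q ⟨$⟩ʳ i ≡ act (toℕ r) (toℕ k) (P ⟨$⟩ʳ_) i) → (∀ i → Q ⟨$⟩ʳ i ≡ act x y (P ⟨$⟩ʳ_) i) →
    InStab₁ Q ((x + (n ∸ toℕ r)) mod n)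
  inStab₁-difference {P} {Q} r k x y Q≗rkP Q≗xyP = ((n ∸ toℕ k) + y) mod n , λ i → begin
    act (toℕ ((x + (n ∸ toℕ r)) mod n)) (toℕ ((n ∸ toℕ k + y) mod n)) Q′ i
      ≡⟨ act-mod (x + (n ∸ toℕ r)) (n ∸ toℕ k + y) Q′ i ⟩
    act (x + (n ∸ toℕ r)) (n ∸ toℕ k + y) Q′ i
      ≡⟨ act-act x y (n ∸ toℕ r) (n ∸ toℕ k) Q′ i ⟨
    act x y (act (n ∸ toℕ r) (n ∸ toℕ k) Q′) i
      ≡⟨ act-cong {g = P ⟨$⟩ʳ_} refl refl (λ j → sym (act-inverse r k Q≗rkP j)) i ⟩
    act x y (P ⟨$⟩ʳ_) i
      ≡⟨ Q≗xyP i ⟨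
    Q′ i ∎
    where Q′ = Q ⟨$⟩ʳ_

  module Stab₁ (P : Perm n) = CyclicSubgroup n (inStab₁? P) (inStab₁-0 P) (inStab₁-+ P)

  period : Perm n → ℕ
  period P = Stab₁.generator P

  stabSize≡count₁ : ∀ P → stabSize n P ≡ length (filter (inStab₁? P) (allFin n))
  stabSize≡count₁ P = length-filter-cartesianProduct (inStab? n P) (inStab₁? P) (allFin n) (allFin n) fibre
    where
    fibre : ∀ r → length (filter (λ k → inStab? n P (r , k)) (allFin n)) ≡ length (filter (inStab₁? P) [ r ])
    fibre r with inStab₁? P r
    ... | yes (k , rk∈P) = length-filter-unique (λ k → inStab? n P (r , k)) (allFin⁺ n) (∈-allFin k) rk∈P
                             (λ rk′∈P → stab-unique {P} rk′∈P rk∈P)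
    ... | no  r∉P        = cong length (filter-none (λ k → inStab? n P (r , k)) (tabulate⁺ λ k rk∈P → r∉P (k , rk∈P)))

  period*stabSize≡n : ∀ P → period P * stabSize n P ≡ n
  period*stabSize≡n P = begin
    period P * stabSize n P                            ≡⟨ cong (period P *_) (stabSize≡count₁ P) ⟩
    period P * length (filter (inStab₁? P) (allFin n)) ≡⟨ cong (period P *_) (Stab₁.count P) ⟩
    period P * (n / period P)                          ≡⟨ m*[n/m]≡n (Stab₁.generator∣n P) ⟩
    n                                                  ∎
    where instance _ = Stab₁.generator-nonZero P

  abstract
    stabSize∣n : ∀ P → stabSize n P ∣ n
    stabSize∣n P = divides (period P) (sym (period*stabSize≡n P))

  module _ (P : Perm n) .{{_ : NonZero (stabSize n P)}} where

    n/stabSize≡period : n / stabSize n P ≡ period P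
    n/stabSize≡period = trans (/-congˡ (sym (period*stabSize≡n P))) (m*n/n≡m (period P) (stabSize n P))

    inStab₁⇒∣ : ∀ {r} → InStab₁ P r → n / stabSize n P ∣ toℕ r
    inStab₁⇒∣ r∈P = subst (_∣ _) (sym n/stabSize≡period) (Stab₁.R⇒∣ P r∈P)

    ∣⇒inStab₁ : ∀ {r} → n / stabSize n P ∣ toℕ r → InStab₁ P r
    ∣⇒inStab₁ m∣r = Stab₁.∣⇒R P (subst (_∣ _) n/stabSize≡period m∣r)

module Canonical (n : ℕ) {{_ : NonZero n}} where
  open Modulo n
  open Rotation n
  open SteggallAction n
  open Stabiliser n

  lexOrder : TotalOrder _ _ _
  lexOrder = lex-≤-totalOrder (Fin-≤-totalOrder n) _≟ᶠ_ n

  open TotalOrder lexOrder using (antisym) renaming (_≤_ to _≤ₗₑₓ_)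
  open import Data.List.Extrema lexOrder using (argmin; f[argmin]≤f[xs])

  values : Perm n → Vec (Fin n) n
  values P = Vec.tabulate (P ⟨$⟩ʳ_)

  values-injective : ∀ {P Q} → values P ≡ values Q → ∀ i → P ⟨$⟩ʳ i ≡ Q ⟨$⟩ʳ i
  values-injective {P} {Q} eq i = begin
    P ⟨$⟩ʳ i                 ≡⟨ lookup∘tabulate (P ⟨$⟩ʳ_) i ⟨
    Vec.lookup (values P) i ≡⟨ cong (λ v → Vec.lookup v i) eq ⟩
    Vec.lookup (values Q) i ≡⟨ lookup∘tabulate (Q ⟨$⟩ʳ_) i ⟩
    Q ⟨$⟩ʳ i                 ∎

  actPerm : Fin n → Fin n → Perm n → Perm n
  actPerm r k P = rotPerm r ∘ₚ (P ∘ₚ rotPerm k)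

  abstract
    canonShift : Perm n → Fin n × Fin n
    canonShift P = argmin (λ (r , k) → values (actPerm r k P)) (0 mod n , 0 mod n)
                          (cartesianProduct (allFin n) (allFin n))

    canon : Perm n → Perm n
    canon P = actPerm (proj₁ (canonShift P)) (proj₂ (canonShift P)) P

    canon-act : ∀ P i → canon P ⟨$⟩ʳ i ≡ act (toℕ (proj₁ (canonShift P))) (toℕ (proj₂ (canonShift P))) (P ⟨$⟩ʳ_) i
    canon-act P i = refl

    canon-minimal : ∀ P r k → values (canon P) ≤ₗₑₓ values (actPerm r k P)
    canon-minimal P r k = All.lookup (f[argmin]≤f[xs] (0 mod n , 0 mod n) _)
                                     (∈-cartesianProduct⁺ (∈-allFin r) (∈-allFin k))

  canonRot : Perm n → ℕ
  canonRot P = toℕ (proj₁ (canonShift P))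

  canon-samePattern : ∀ P → SamePattern n P (canon P)
  canon-samePattern P = proj₁ (canonShift P) , proj₂ (canonShift P) , canon-act P

  canon-≤ : ∀ {P Q} → SamePattern n P Q → values (canon P) ≤ₗₑₓ values (canon Q)
  canon-≤ {P} {Q} (r , k , Q≗rkP) = subst (values (canon P) ≤ₗₑₓ_) (tabulate-cong same) (canon-minimal P _ _)
    where
    r₁ = toℕ (proj₁ (canonShift Q))
    k₁ = toℕ (proj₂ (canonShift Q))
    same : ∀ i → act (toℕ ((r₁ + toℕ r) mod n)) (toℕ ((toℕ k + k₁) mod n)) (P ⟨$⟩ʳ_) i ≡ canon Q ⟨$⟩ʳ i
    same i = begin
      act (toℕ ((r₁ + toℕ r) mod n)) (toℕ ((toℕ k + k₁) mod n)) (P ⟨$⟩ʳ_) i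
        ≡⟨ act-mod (r₁ + toℕ r) (toℕ k + k₁) (P ⟨$⟩ʳ_) i ⟩
      act (r₁ + toℕ r) (toℕ k + k₁) (P ⟨$⟩ʳ_) i
        ≡⟨ act-act r₁ k₁ (toℕ r) (toℕ k) (P ⟨$⟩ʳ_) i ⟨
      act r₁ k₁ (act (toℕ r) (toℕ k) (P ⟨$⟩ʳ_)) i
        ≡⟨ act-cong refl refl (λ j → sym (Q≗rkP j)) i ⟩
      act r₁ k₁ (Q ⟨$⟩ʳ_) i
        ≡⟨ canon-act Q i ⟨
      canon Q ⟨$⟩ʳ i ∎

  canon-cong : ∀ {P Q} → SamePattern n P Q → ∀ i → canon Q ⟨$⟩ʳ i ≡ canon P ⟨$⟩ʳ i
  canon-cong {P} {Q} P~Q = values-injective {canon Q} {canon P}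
    (Pointwise-≡⇒≡ (antisym (canon-≤ {Q} {P} (samePattern-sym {P} {Q} P~Q)) (canon-≤ {P} {Q} P~Q)))

  canon-samePattern-cong : ∀ {P Q} → SamePattern n P Q → SamePattern n (canon P) (canon Q)
  canon-samePattern-cong {P} {Q} P~Q = samePattern-≗ {canon P} {canon Q} (canon-cong {P} {Q} P~Q)

  -- Relative to π, canon π = canon π′ has the coordinates canonShift π and canonShift π′ + (a, b);
  -- their difference stabilises canon π, so its rotation part is a multiple of n / |Stab(canon π)|.
  canon-offset : ∀ {π π′ : Perm n} a b → (∀ i → π′ ⟨$⟩ʳ i ≡ act a b (π ⟨$⟩ʳ_) i) →
                 .{{_ : NonZero (stabSize n (canon π))}} →
                 ∃[ j ] (canonRot π + n / stabSize n (canon π) * j) % n ≡ (canonRot π′ + a) % n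
  canon-offset {π} {π′} a b π′≗abπ = j , (begin
      (toℕ r + m * j) % n         ≡⟨ cong (λ y → (toℕ r + y) % n) (trans (*-comm m j) (sym c≡jm)) ⟩
      (toℕ r + toℕ (c mod n)) % n ≡⟨ [r+[x+[n∸r]]%n]%n≡x%n (toℕ r₁ + a) (<⇒≤ (toℕ<n r)) ⟩
      (toℕ r₁ + a) % n            ∎)
    where
    m = n / stabSize n (canon π)
    r = proj₁ (canonShift π)
    r₁ = proj₁ (canonShift π′)
    k₁ = proj₂ (canonShift π′)
    c = toℕ r₁ + a + (n ∸ toℕ r)
    canonπ≗ : ∀ i → canon π ⟨$⟩ʳ i ≡ act (toℕ r₁ + a) (b + toℕ k₁) (π ⟨$⟩ʳ_) i
    canonπ≗ i = begin
      canon π ⟨$⟩ʳ i                              ≡⟨ canon-cong {π} {π′} (samePattern a b {π} {π′} π′≗abπ) i ⟨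
      canon π′ ⟨$⟩ʳ i                             ≡⟨ canon-act π′ i ⟩
      act (toℕ r₁) (toℕ k₁) (π′ ⟨$⟩ʳ_) i          ≡⟨ act-cong refl refl π′≗abπ i ⟩
      act (toℕ r₁) (toℕ k₁) (act a b (π ⟨$⟩ʳ_)) i ≡⟨ act-act (toℕ r₁) (toℕ k₁) a b (π ⟨$⟩ʳ_) i ⟩
      act (toℕ r₁ + a) (b + toℕ k₁) (π ⟨$⟩ʳ_) i   ∎
    m∣c : m ∣ toℕ (c mod n)
    m∣c = inStab₁⇒∣ (canon π) (inStab₁-difference {π} {canon π} r (proj₂ (canonShift π)) (toℕ r₁ + a) (b + toℕ k₁)
                                 (canon-act π) canonπ≗)
    j = quotient m∣c
    c≡jm : toℕ (c mod n) ≡ j * m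
    c≡jm = _∣_.equality m∣c

module Transposition (n : ℕ) {{_ : NonZero n}} where
  open Modulo n

  transpose : (a b : ℕ) .{{_ : NonZero a}} → Fin n → Fin n
  transpose a b i = (toℕ i / a + toℕ i % a * b) mod n

  module _ (a b : ℕ) .{{_ : NonZero a}} .{{_ : NonZero b}} (a*b≡n : a * b ≡ n) where

    quotient<b : ∀ (i : Fin n) → toℕ i / a < b
    quotient<b i = m<n*o⇒m/o<n (subst (toℕ i <_) (trans (sym a*b≡n) (*-comm a b)) (toℕ<n i))

    toℕ-transpose : ∀ i → toℕ (transpose a b i) ≡ toℕ i / a + toℕ i % a * b
    toℕ-transpose i = trans (toℕ-mod _)
      (m<n⇒m%n≡m (subst (toℕ i / a + toℕ i % a * b <_) a*b≡n (q+tb<ab (quotient<b i) (m%n<n (toℕ i) a))))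

  abstract
    transpose-inverse : ∀ a b .{{_ : NonZero a}} .{{_ : NonZero b}} → a * b ≡ n →
                        ∀ i → transpose b a (transpose a b i) ≡ i
    transpose-inverse a b a*b≡n i = toℕ-injective $ begin
      toℕ (transpose b a (transpose a b i))
        ≡⟨ toℕ-transpose b a (trans (*-comm b a) a*b≡n) (transpose a b i) ⟩
      toℕ (transpose a b i) / b + toℕ (transpose a b i) % b * a
        ≡⟨ cong (λ x → x / b + x % b * a) (toℕ-transpose a b a*b≡n i) ⟩
      (q + t * b) / b + (q + t * b) % b * a
        ≡⟨ cong₂ (λ x y → x + y * a) ([t+qk]/k≡q t q<b) ([t+qk]%k≡t t q<b) ⟩
      t + q * a
        ≡⟨ m≡m%n+[m/n]*n (toℕ i) a ⟨
      toℕ i ∎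
      where
      q t : ℕ
      q = toℕ i / a
      t = toℕ i % a
      q<b : q < b
      q<b = quotient<b a b a*b≡n i

module Conjugation (n : ℕ) {{_ : NonZero n}} {d : ℕ} (d∣n : d ∣ n) where
  open Modulo n
  open Rotation n
  open Transposition n

  d-nonZero : NonZero d
  d-nonZero = ∣-nonZero d∣n

  private instance _ = d-nonZero

  m : ℕ
  m = n / d

  d*m≡n : d * m ≡ n
  d*m≡n = m*[n/m]≡n d∣n

  m-nonZero : NonZero m
  m-nonZero = m*n≢0⇒n≢0 d {{subst NonZero (sym d*m≡n) it}}

  private instance _ = m-nonZero

  -- ρ transposes the grid, q·d + t ↦ t·m + q; σ_(d^{n/d}) advances t cyclically, which ρ turns into
  -- adding m modulo n = d·m.
  ρ : Perm n
  ρ = permutation (transpose d m) (transpose m d)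
        (transpose-inverse m d (trans (*-comm m d) d*m≡n)) (transpose-inverse d m d*m≡n)

  ρ-σ : ∀ i → ρ ⟨$⟩ʳ σ n d i ≡ rot m (ρ ⟨$⟩ʳ i)
  ρ-σ i = toℕ-injective $ begin
    toℕ (transpose d m (σ n d i))
      ≡⟨ toℕ-transpose d m d*m≡n (σ n d i) ⟩
    toℕ (σ n d i) / d + toℕ (σ n d i) % d * m
      ≡⟨ cong (λ x → x / d + x % d * m) toℕ-σ ⟩
    (t′ + q * d) / d + (t′ + q * d) % d * m
      ≡⟨ cong₂ (λ x y → x + y * m) ([t+qk]/k≡q q t′<d) ([t+qk]%k≡t q t′<d) ⟩
    q + t′ * m
      ≡⟨ m<n⇒m%n≡m (subst (q + t′ * m <_) d*m≡n (q+tb<ab q<m t′<d)) ⟨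
    (q + t′ * m) % n
      ≡⟨ cong (λ x → (q + x) % n) t′*m≡[1+t]*m%n ⟩
    (q + suc t * m % n) % n
      ≡⟨ [x+y%n]%n≡[x+y]%n q (suc t * m) ⟩
    (q + (m + t * m)) % n
      ≡⟨ cong (_% n) (trans (cong (q +_) (+-comm m (t * m))) (sym (+-assoc q (t * m) m))) ⟩
    (q + t * m + m) % n
      ≡⟨ cong (λ x → (x + m) % n) (toℕ-transpose d m d*m≡n i) ⟨
    (toℕ (transpose d m i) + m) % n
      ≡⟨ toℕ-mod _ ⟨
    toℕ (rot m (transpose d m i)) ∎
    where
    q = toℕ i / d
    t = toℕ i % d
    t′ = suc t % d
    t′<d : t′ < d
    t′<d = m%n<n (suc t) d
    q<m : q < m
    q<m = quotient<b d m d*m≡n i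
    toℕ-σ : toℕ (σ n d i) ≡ t′ + q * d
    toℕ-σ = begin
      toℕ (σ n d i)    ≡⟨ toℕ-mod _ ⟩
      (d * q + t′) % n ≡⟨ cong (_% n) (trans (+-comm (d * q) t′) (cong (t′ +_) (*-comm d q))) ⟩
      (t′ + q * d) % n ≡⟨ m<n⇒m%n≡m (subst (t′ + q * d <_) (trans (*-comm m d) d*m≡n) (q+tb<ab t′<d q<m)) ⟩
      t′ + q * d       ∎
    t′*m≡[1+t]*m%n : t′ * m ≡ suc t * m % n
    t′*m≡[1+t]*m%n = trans (m%n*o≡m*o%[n*o] (suc t) d m {{_}} {{subst NonZero (sym d*m≡n) it}})
                           (%-congʳ {{_}} d*m≡n)

  ρ-iter-σ : ∀ j i → ρ ⟨$⟩ʳ iter (σ n d) j i ≡ rot (m * j) (ρ ⟨$⟩ʳ i)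
  ρ-iter-σ zero    i = trans (sym (rot-0 _)) (cong (λ a → rot a (ρ ⟨$⟩ʳ i)) (sym (*-zeroʳ m)))
  ρ-iter-σ (suc j) i = begin
    ρ ⟨$⟩ʳ σ n d (iter (σ n d) j i)
      ≡⟨ ρ-σ _ ⟩
    rot m (ρ ⟨$⟩ʳ iter (σ n d) j i)
      ≡⟨ cong (rot m) (ρ-iter-σ j i) ⟩
    rot m (rot (m * j) (ρ ⟨$⟩ʳ i))
      ≡⟨ rot-+ (m * j) m _ ⟩
    rot (m * j + m) (ρ ⟨$⟩ʳ i)
      ≡⟨ cong (λ a → rot a (ρ ⟨$⟩ʳ i)) (trans (+-comm (m * j) m) (sym (*-suc m j))) ⟩
    rot (m * suc j) (ρ ⟨$⟩ʳ i) ∎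

  iter-σ-ρ⁻¹ : ∀ j x → iter (σ n d) j (ρ ⟨$⟩ˡ x) ≡ ρ ⟨$⟩ˡ rot (m * j) x
  iter-σ-ρ⁻¹ j x = begin
    iter (σ n d) j (ρ ⟨$⟩ˡ x)                ≡⟨ inverseˡ ρ ⟨
    ρ ⟨$⟩ˡ (ρ ⟨$⟩ʳ iter (σ n d) j (ρ ⟨$⟩ˡ x)) ≡⟨ cong (ρ ⟨$⟩ˡ_) (ρ-iter-σ j (ρ ⟨$⟩ˡ x)) ⟩
    ρ ⟨$⟩ˡ rot (m * j) (ρ ⟨$⟩ʳ (ρ ⟨$⟩ˡ x))    ≡⟨ cong (λ y → ρ ⟨$⟩ˡ rot (m * j) y) (inverseʳ ρ) ⟩
    ρ ⟨$⟩ˡ rot (m * j) x                     ∎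

  sameCoset-rot : ∀ {λ′ μ′ : Perm n} (F : Fin n → Fin n) a b j → (a + m * j) % n ≡ b % n →
                  (∀ i → λ′ ⟨$⟩ʳ i ≡ F (rot a (ρ ⟨$⟩ʳ i))) → (∀ i → μ′ ⟨$⟩ʳ i ≡ F (rot b (ρ ⟨$⟩ʳ i))) →
                  SameCoset n d λ′ μ′
  sameCoset-rot {λ′} {μ′} F a b j a+mj≡b λ′≗ μ′≗ = j , λ i → begin
    μ′ ⟨$⟩ʳ i
      ≡⟨ μ′≗ i ⟩
    F (rot b (ρ ⟨$⟩ʳ i))
      ≡⟨ cong F (rot-cong (trans (sym a+mj≡b) (cong (_% n) (+-comm a (m * j)))) _) ⟩
    F (rot (m * j + a) (ρ ⟨$⟩ʳ i))
      ≡⟨ cong F (rot-+ (m * j) a _) ⟨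
    F (rot a (rot (m * j) (ρ ⟨$⟩ʳ i)))
      ≡⟨ cong (F ∘ rot a) (ρ-iter-σ j i) ⟨
    F (rot a (ρ ⟨$⟩ʳ iter (σ n d) j i))
      ≡⟨ λ′≗ _ ⟨
    λ′ ⟨$⟩ʳ iter (σ n d) j i ∎

module Isomorphism (n : ℕ) {{_ : NonZero n}} where
  open Modulo n
  open Rotation n
  open SteggallAction n
  open Stabiliser n
  open Canonical n
  module Conj {d} (h : d ∣ n) = Conjugation n h

  ρ-cong : ∀ {d d′} (h : d ∣ n) (h′ : d′ ∣ n) → d ≡ d′ → ∀ i → Conj.ρ h ⟨$⟩ʳ i ≡ Conj.ρ h′ ⟨$⟩ʳ i
  ρ-cong h h′ refl i = refl

  ρ⁻¹-cong : ∀ {d d′} (h : d ∣ n) (h′ : d′ ∣ n) → d ≡ d′ → ∀ i → Conj.ρ h ⟨$⟩ˡ i ≡ Conj.ρ h′ ⟨$⟩ˡ i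
  ρ⁻¹-cong h h′ refl i = refl

  -- i ↦ λ₁⁻¹ (λ₂ i), that is, π = λ₁⁻¹λ₂
  relative : Perm n → Perm n → Perm n
  relative λ₁ λ₂ = λ₂ ∘ₚ flip λ₁

  toPattern : CnCn n → Perm n
  toPattern (λ₁ , λ₂) = canon (relative λ₁ λ₂)

  toLabelling : CnCn n → Perm n
  toLabelling x@(λ₁ , λ₂) = Conj.ρ (stabSize∣n (toPattern x)) ∘ₚ (rotPerm (proj₁ (canonShift (relative λ₁ λ₂))) ∘ₚ λ₂)

  toRHS : CnCn n → RHS n
  toRHS x = toPattern x , stabSize∣n (toPattern x) , toLabelling x

  fromRHS : RHS n → CnCn n
  fromRHS (P , h , λ′) = flip (canon P) ∘ₚ λ₂ , λ₂
    where λ₂ = flip (Conj.ρ h) ∘ₚ λ′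

  to-cong : ∀ {x y} → x ≈CnCn y → toRHS x ≈RHS toRHS y
  to-cong {λ₁ , λ₂} {μ₁ , μ₂} ((a , μ₁≗) , (b , μ₂≗)) = canon-samePattern-cong {π} {π′} π~π′ , coset
    where
    π = relative λ₁ λ₂
    π′ = relative μ₁ μ₂
    A = n ∸ toℕ (a mod n)
    μ₂≗λ₂rot : ∀ i → μ₂ ⟨$⟩ʳ i ≡ λ₂ ⟨$⟩ʳ rot b i
    μ₂≗λ₂rot i = trans (μ₂≗ i) (cong (λ₂ ⟨$⟩ʳ_) (iter-σ-n b i))
    π′≗ : ∀ i → π′ ⟨$⟩ʳ i ≡ act b A (π ⟨$⟩ʳ_) i
    π′≗ i = trans (inverse-rot {λ₁} {μ₁} a (λ i → trans (μ₁≗ i) (cong (λ₁ ⟨$⟩ʳ_) (iter-σ-n a i))) _)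
                  (cong (rot A ∘ (λ₁ ⟨$⟩ˡ_)) (μ₂≗λ₂rot i))
    π~π′ : SamePattern n π π′
    π~π′ = samePattern b A {π} {π′} π′≗
    h = stabSize∣n (canon π)
    h′ = stabSize∣n (canon π′)
    instance _ = Conj.d-nonZero h
    ρ′≗ρ : ∀ i → Conj.ρ h′ ⟨$⟩ʳ i ≡ Conj.ρ h ⟨$⟩ʳ i
    ρ′≗ρ = ρ-cong h′ h (stabSize-cong {canon π} {canon π′} (canon-samePattern-cong {π} {π′} π~π′))
    offset = canon-offset {π} {π′} b A π′≗
    coset : SameCoset n (stabSize n (canon π)) (toLabelling (λ₁ , λ₂)) (toLabelling (μ₁ , μ₂))
    coset = Conj.sameCoset-rot h {toLabelling (λ₁ , λ₂)} {toLabelling (μ₁ , μ₂)} (λ₂ ⟨$⟩ʳ_)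
              (canonRot π) (canonRot π′ + b) (proj₁ offset) (proj₂ offset) (λ i → refl) λ i → begin
      μ₂ ⟨$⟩ʳ rot (canonRot π′) (Conj.ρ h′ ⟨$⟩ʳ i)
        ≡⟨ μ₂≗λ₂rot _ ⟩
      λ₂ ⟨$⟩ʳ rot b (rot (canonRot π′) (Conj.ρ h′ ⟨$⟩ʳ i))
        ≡⟨ cong (λ₂ ⟨$⟩ʳ_) (rot-+ (canonRot π′) b _) ⟩
      λ₂ ⟨$⟩ʳ rot (canonRot π′ + b) (Conj.ρ h′ ⟨$⟩ʳ i)
        ≡⟨ cong ((λ₂ ⟨$⟩ʳ_) ∘ rot (canonRot π′ + b)) (ρ′≗ρ i) ⟩
      λ₂ ⟨$⟩ʳ rot (canonRot π′ + b) (Conj.ρ h ⟨$⟩ʳ i) ∎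

  natural : ∀ τ x → toRHS (actCnCn τ x) ≈RHS actRHS τ (toRHS x)
  natural τ (λ₁ , λ₂) = canon-samePattern-cong {πτ} {π} πτ~π , coset
    where
    π = relative λ₁ λ₂
    πτ = relative (transport τ λ₁) (transport τ λ₂)
    π≗πτ : ∀ i → π ⟨$⟩ʳ i ≡ act 0 0 (πτ ⟨$⟩ʳ_) i
    π≗πτ i = trans (cong (λ₁ ⟨$⟩ˡ_) (sym (inverseˡ τ))) (sym (act-0 (πτ ⟨$⟩ʳ_) i))
    πτ~π : SamePattern n πτ π
    πτ~π = samePattern 0 0 {πτ} {π} π≗πτ
    h = stabSize∣n (canon π)
    hτ = stabSize∣n (canon πτ)
    instance _ = Conj.d-nonZero hτ
    ρ≗ρτ : ∀ i → Conj.ρ h ⟨$⟩ʳ i ≡ Conj.ρ hτ ⟨$⟩ʳ i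
    ρ≗ρτ = ρ-cong h hτ (stabSize-cong {canon πτ} {canon π} (canon-samePattern-cong {πτ} {π} πτ~π))
    offset = canon-offset {πτ} {π} 0 0 π≗πτ
    coset : SameCoset n (stabSize n (canon πτ)) (toLabelling (actCnCn τ (λ₁ , λ₂))) (transport τ (toLabelling (λ₁ , λ₂)))
    coset = Conj.sameCoset-rot hτ {toLabelling (actCnCn τ (λ₁ , λ₂))} {transport τ (toLabelling (λ₁ , λ₂))}
              (λ i → τ ⟨$⟩ʳ (λ₂ ⟨$⟩ʳ i)) (canonRot πτ) (canonRot π + 0) (proj₁ offset) (proj₂ offset) (λ i → refl)
              λ i → cong (λ y → τ ⟨$⟩ʳ (λ₂ ⟨$⟩ʳ y))
                      (trans (cong (rot (canonRot π)) (ρ≗ρτ i)) (rot-cong (cong (_% n) (sym (+-identityʳ (canonRot π)))) _))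

  from-cong : ∀ {x y} → x ≈RHS y → fromRHS x ≈CnCn fromRHS y
  from-cong {P , h , λ′} {Q , h′ , μ} (P~Q , (j , μ≗)) = first , second
    where
    instance _ = Conj.d-nonZero h
    m = Conj.m h
    λ₂ = flip (Conj.ρ h) ∘ₚ λ′
    μ₂ = flip (Conj.ρ h′) ∘ₚ μ
    μ₂≗ : ∀ x → μ₂ ⟨$⟩ʳ x ≡ λ₂ ⟨$⟩ʳ rot (m * j) x
    μ₂≗ x = begin
      μ ⟨$⟩ʳ (Conj.ρ h′ ⟨$⟩ˡ x)
        ≡⟨ cong (μ ⟨$⟩ʳ_) (ρ⁻¹-cong h′ h (stabSize-cong {P} {Q} P~Q) x) ⟩
      μ ⟨$⟩ʳ (Conj.ρ h ⟨$⟩ˡ x)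
        ≡⟨ μ≗ _ ⟩
      λ′ ⟨$⟩ʳ iter (σ n _) j (Conj.ρ h ⟨$⟩ˡ x)
        ≡⟨ cong (λ′ ⟨$⟩ʳ_) (Conj.iter-σ-ρ⁻¹ h j x) ⟩
      λ′ ⟨$⟩ʳ (Conj.ρ h ⟨$⟩ˡ rot (m * j) x) ∎
    second : SameCoset n n λ₂ μ₂
    second = sameCoset-n {λ₂} {μ₂} (m * j) μ₂≗
    m∣mj%n : m ∣ toℕ ((m * j) mod n)
    m∣mj%n = subst (m ∣_) (sym (toℕ-mod (m * j)))
                   (%-presˡ-∣ (m∣m*n j) (divides (stabSize n P) (sym (Conj.d*m≡n h))))
    mj∈P₀ : InStab₁ (canon P) ((m * j) mod n)
    mj∈P₀ = inStab₁-transport {P} {canon P} (canon-samePattern P) (∣⇒inStab₁ P m∣mj%n)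
    k′ = proj₁ mj∈P₀
    first : SameCoset n n (flip (canon P) ∘ₚ λ₂) (flip (canon Q) ∘ₚ μ₂)
    first = sameCoset-n {flip (canon P) ∘ₚ λ₂} {flip (canon Q) ∘ₚ μ₂} (n ∸ toℕ k′) λ y → begin
      μ₂ ⟨$⟩ʳ (canon Q ⟨$⟩ˡ y)
        ≡⟨ μ₂≗ _ ⟩
      λ₂ ⟨$⟩ʳ rot (m * j) (canon Q ⟨$⟩ˡ y)
        ≡⟨ cong ((λ₂ ⟨$⟩ʳ_) ∘ rot (m * j)) (⟨$⟩ˡ-cong {canon P} {canon Q} (canon-cong {P} {Q} P~Q) y) ⟩
      λ₂ ⟨$⟩ʳ rot (m * j) (canon P ⟨$⟩ˡ y)
        ≡⟨ cong (λ₂ ⟨$⟩ʳ_) (rot-mod (m * j) _) ⟨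
      λ₂ ⟨$⟩ʳ rot (toℕ ((m * j) mod n)) (canon P ⟨$⟩ˡ y)
        ≡⟨ cong (λ₂ ⟨$⟩ʳ_) (inStab-inverse {canon P} (proj₂ mj∈P₀) y) ⟩
      λ₂ ⟨$⟩ʳ (canon P ⟨$⟩ˡ rot (n ∸ toℕ k′) y) ∎

  from-to : ∀ x → fromRHS (toRHS x) ≈CnCn x
  from-to (λ₁ , λ₂) = first , second
    where
    π = relative λ₁ λ₂
    r = proj₁ (canonShift π)
    k = proj₂ (canonShift π)
    h = stabSize∣n (canon π)
    λ₂′ = flip (Conj.ρ h) ∘ₚ toLabelling (λ₁ , λ₂)
    λ₂′≗ : ∀ x → λ₂′ ⟨$⟩ʳ x ≡ λ₂ ⟨$⟩ʳ rot (toℕ r) x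
    λ₂′≗ x = cong ((λ₂ ⟨$⟩ʳ_) ∘ rot (toℕ r)) (inverseʳ (Conj.ρ h))
    second : SameCoset n n λ₂′ λ₂
    second = sameCoset-n {λ₂′} {λ₂} (n ∸ toℕ r) λ x →
      trans (cong (λ₂ ⟨$⟩ʳ_) (sym (rot-complementʳ r x))) (sym (λ₂′≗ _))
    first : SameCoset n n (flip (canon (canon π)) ∘ₚ λ₂′) λ₁
    first = sameCoset-n {flip (canon (canon π)) ∘ₚ λ₂′} {λ₁} (toℕ k) λ x → sym $ begin
      λ₂′ ⟨$⟩ʳ (canon (canon π) ⟨$⟩ˡ rot (toℕ k) x)
        ≡⟨ cong (λ₂′ ⟨$⟩ʳ_) (⟨$⟩ˡ-cong {canon π} {canon (canon π)} (canon-cong {π} {canon π} (canon-samePattern π)) _) ⟩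
      λ₂′ ⟨$⟩ʳ (canon π ⟨$⟩ˡ rot (toℕ k) x)
        ≡⟨ cong (λ₂′ ⟨$⟩ʳ_) (inverse-act {π} {canon π} r k (canon-act π) x) ⟩
      λ₂′ ⟨$⟩ʳ rot (n ∸ toℕ r) (π ⟨$⟩ˡ x)
        ≡⟨ λ₂′≗ _ ⟩
      λ₂ ⟨$⟩ʳ rot (toℕ r) (rot (n ∸ toℕ r) (π ⟨$⟩ˡ x))
        ≡⟨ cong (λ₂ ⟨$⟩ʳ_) (rot-complementʳ r _) ⟩
      λ₂ ⟨$⟩ʳ (λ₂ ⟨$⟩ˡ (λ₁ ⟨$⟩ʳ x))
        ≡⟨ inverseʳ λ₂ ⟩
      λ₁ ⟨$⟩ʳ x ∎

  to-from : ∀ y → toRHS (fromRHS y) ≈RHS y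
  to-from (P , h , λ′) = canonπ~P , coset
    where
    λ₂ = flip (Conj.ρ h) ∘ₚ λ′
    λ₁ = flip (canon P) ∘ₚ λ₂
    π = relative λ₁ λ₂
    r = proj₁ (canonShift P)
    k = proj₂ (canonShift P)
    P≗ : ∀ i → P ⟨$⟩ʳ i ≡ act (n ∸ toℕ r) (n ∸ toℕ k) (π ⟨$⟩ʳ_) i
    P≗ = act-inverse r k {P ⟨$⟩ʳ_} {π ⟨$⟩ʳ_} (λ i → trans (cong (canon P ⟨$⟩ʳ_) (inverseˡ λ₂)) (canon-act P i))
    canonπ~P : SamePattern n (canon π) P
    canonπ~P = samePattern (n ∸ toℕ r) (n ∸ toℕ k) {canon π} {P} λ i →
      trans (act-inverse r k {P ⟨$⟩ʳ_} {canon P ⟨$⟩ʳ_} (canon-act P) i)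
            (act-cong refl refl (canon-cong {π} {P} (samePattern (n ∸ toℕ r) (n ∸ toℕ k) {π} {P} P≗)) i)
    h″ = stabSize∣n (canon π)
    instance _ = Conj.d-nonZero h″
    offset = canon-offset {π} {P} (n ∸ toℕ r) (n ∸ toℕ k) P≗
    coset : SameCoset n (stabSize n (canon π)) (toLabelling (λ₁ , λ₂)) λ′
    coset = Conj.sameCoset-rot h″ {toLabelling (λ₁ , λ₂)} {λ′} (λ₂ ⟨$⟩ʳ_) (canonRot π) (canonRot P + (n ∸ toℕ r))
              (proj₁ offset) (proj₂ offset) (λ i → refl) λ i → sym $ begin
      λ₂ ⟨$⟩ʳ rot (toℕ r + (n ∸ toℕ r)) (Conj.ρ h″ ⟨$⟩ʳ i)
        ≡⟨ cong (λ₂ ⟨$⟩ʳ_) (rot-multiple (+-complement%n r) _) ⟩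
      λ₂ ⟨$⟩ʳ (Conj.ρ h″ ⟨$⟩ʳ i)
        ≡⟨ cong (λ₂ ⟨$⟩ʳ_) (ρ-cong h h″ (stabSize-cong {canon π} {P} canonπ~P) i) ⟨
      λ′ ⟨$⟩ʳ (Conj.ρ h ⟨$⟩ˡ (Conj.ρ h ⟨$⟩ʳ i))
        ≡⟨ cong (λ′ ⟨$⟩ʳ_) (inverseˡ (Conj.ρ h)) ⟩
      λ′ ⟨$⟩ʳ i ∎

mainTheorem15 : (n : ℕ) {{_ : NonZero n}} →
    SpeciesIso n (CnCn n) _≈CnCn_ actCnCn (RHS n) _≈RHS_ actRHS
mainTheorem15 n = record
  { to        = toRHS
  ; from      = fromRHS
  ; to-cong   = λ {x} {y} → to-cong {x} {y}
  ; from-cong = λ {x} {y} → from-cong {x} {y}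
  ; from-to   = from-to
  ; to-from   = to-from
  ; natural   = natural
  }
  where open Isomorphism n
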